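{- Let $X$ and $Y$ be edge-disjoint matchings of sizes $x$ and $y$ respectively. Suppose that $Y$ has $y_1$ edges that are adjacent to exactly one edge in $X$ and $y_2$ edges adjacent to exactly two edges in $X$. Let $\ell_{Y}$ be an ordering of $Y$ in which the $y_2$ edges adjacent to two edges in $X$ are the last to occur. Then there is an ordering $\ell_{X}$ of $X$ such that \[\mathrm{ms}( \ell_{X}\vee\ell_{Y}) \geq \min\{x,\ x+y-y_1-2y_2\}.\]
   Context: All graphs are simple; a matching is a 1-regular graph; two edges are adjacent if they share a vertex. An ordering of a graph $G$ with $m$ edges is a bijection $\ell:E(G)\to\mathbb{Z}_m$; for distinct edges $e,e'$, $d_\ell(e,e')$ is the smallest positive integer $d$ with $\ell(e)+d=\ell(e')$ in $\mathbb{Z}_m$. $\mathrm{ms}(\ell)$ is the largest $s\in\{1,\dots,m\}$ such that $d_\ell(e,e')\geq s$ for every ordered pair $(e,e')$ of adjacent edges with $\ell(e)<\ell(e')$. For edge-disjoint graphs $G_0,G_1$ with orderings $\ell_0,\ell_1$, $\ell_0\vee\ell_1$ is the ordering $\ell$ of $G_0\cup G_1$ with $\ell(e)=\ell_0(e)$ for $e\in E(G_0)$ and $\ell(e)=|E(G_0)|+\ell_1(e)$ for $e\in E(G_1)$. -}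

module Defs where

open import Data.Nat using (ℕ; _<_; _≤_; _∸_)
open import Data.Nat.Properties using (<-irrelevant) renaming (_≟_ to _≟ℕ_)
open import Data.Fin using (Fin; toℕ)
open import Data.List using (List; length; filter; lookup)
open import Data.List.Relation.Unary.AllPairs using (AllPairs)
open import Data.List.Relation.Unary.Unique.Propositional using (Unique)
open import Data.Product using (_×_; _,_)
open import Data.Sum using (_⊎_; inj₁; inj₂)
open import Relation.Nullary using (¬_; Dec; yes; no)
open import Relation.Nullary.Decidable using (_×-dec_; _⊎-dec_; ¬?)
open import Relation.Binary.PropositionalEquality using (_≡_; _≢_; refl; cong)

-- An edge of a simple graph is an
-- unordered pair {a , b} of distinct vertices, stored canonically with a < b,
-- so that two edges are equal iff they are equal as sets.
record Edge : Set where
  constructor edge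
  field
    a b : ℕ
    a<b : a < b
open Edge public

_≟E_ : (e f : Edge) → Dec (e ≡ f)
edge a b p ≟E edge a' b' p' with a ≟ℕ a' | b ≟ℕ b'
... | yes refl | yes refl = yes (cong (edge a b) (<-irrelevant p p'))
... | no ne | _ = no λ { refl → ne refl }
... | yes _ | no ne = no λ { refl → ne refl }

Shares : Edge → Edge → Set
Shares e f = (a e ≡ a f ⊎ a e ≡ b f) ⊎ (b e ≡ a f ⊎ b e ≡ b f)

shares? : (e f : Edge) → Dec (Shares e f)
shares? e f = ((a e ≟ℕ a f) ⊎-dec (a e ≟ℕ b f)) ⊎-dec ((b e ≟ℕ a f) ⊎-dec (b e ≟ℕ b f))

Adjacent : Edge → Edge → Set
Adjacent e f = e ≢ f × Shares e f

adjacent? : (e f : Edge) → Dec (Adjacent e f)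
adjacent? e f = ¬? (e ≟E f) ×-dec shares? e f

-- A (finite) graph is given by the list of its edges, without repetition.
-- A matching (1-regular graph): distinct edges, pairwise vertex-disjoint.
IsMatching : List Edge → Set
IsMatching X = Unique X × AllPairs (λ e f → ¬ Shares e f) X

EdgeDisjoint : List Edge → List Edge → Set
EdgeDisjoint X Y = ∀ {e} → e Data.List.Membership.Propositional.∈ X → ¬ (e Data.List.Membership.Propositional.∈ Y)
  where import Data.List.Membership.Propositional

nbrs : List Edge → Edge → ℕ
nbrs X e = length (filter (adjacent? e) X)

countAdj : List Edge → List Edge → ℕ → ℕ
countAdj X Y k = length (filter (λ e → nbrs X e ≟ℕ k) Y)

-- An ordering ℓ of a graph with m edges is represented by a list L of length m
-- enumerating the edges without repetition: ℓ(e) = position of e in L.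
Spread : List Edge → ℕ → Set
Spread L s = (i j : Fin (length L)) → toℕ i < toℕ j →
             Adjacent (lookup L i) (lookup L j) → s ≤ toℕ j ∸ toℕ i

IsMs : List Edge → ℕ → Set
IsMs L s = (1 ≤ s × s ≤ length L) × Spread L s
         × (∀ t → s < t → t ≤ length L → ¬ Spread L t)

-- The join ℓ₀ ∨ ℓ₁ of orderings is list concatenation.

-- Order X greedily along ℓY = y₁ … y_m: first the edges of X adjacent to y₁, then
-- the remaining ones adjacent to y₂, and so on, with the edges adjacent to no yⱼ
-- last.  An edge of X adjacent to yⱼ then lies among the first d₁ + ⋯ + dⱼ
-- positions, where dᵢ is the number of X-edges adjacent to yᵢ, so its distance to
-- yⱼ (at position x + j) is at least x − (d₁ + ⋯ + dⱼ − j).  An edge meets at most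
-- two edges of the matching X, so the dᵢ are at most 1 before the edges with two
-- X-neighbours and equal to 2 from then on; hence the excess
-- d₁ + ⋯ + dⱼ − j is largest at j = 0 or j = m, so it is at most
-- max(0, y₁ + 2y₂ − y).  Both X and Y are matchings, so no other pairs of edges
-- are adjacent.

module Submission where

open import Defs

module GreedyOrdering where

  open import Data.Nat using (ℕ; zero; suc; _+_; _∸_; _≤_; _<_; z≤n; s≤s; s≤s⁻¹; _≟_)
  open import Data.Nat.Properties
  open import Data.Fin using (Fin; toℕ; zero; suc)
  open import Data.Fin.Properties using (toℕ<n)
  open import Data.List using (List; []; _∷_; length; _++_; filter; lookup; map; take)
  open import Data.Nat.ListAction using (sum)
  open import Data.List.Properties
    using ( length-++; length-map; map-++
          ; filter-++; filter-accept; filter-reject; filter-all; filter-none)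
  open import Data.List.Relation.Unary.All as All using (All; []; _∷_)
  open import Data.List.Relation.Unary.All.Properties using (all-filter) renaming (map⁺ to All-map⁺)
  open import Data.List.Relation.Unary.AllPairs using (AllPairs; []; _∷_)
  open import Data.List.Relation.Unary.AllPairs.Properties as AllPairs using ()
  open import Data.List.Relation.Unary.Any using (here; there)
  open import Data.List.Membership.Propositional using (_∈_)
  open import Data.List.Membership.Propositional.Properties using (∈-lookup; ∈-filter⁻)
  open import Data.List.Relation.Binary.Sublist.Propositional using (_⊆_)
  open import Data.List.Relation.Binary.Sublist.Propositional.Properties
    using (filter-⊆; filter⁺; length-mono-≤)
  open import Data.List.Relation.Binary.Permutation.Propositional using (_↭_; refl; prep; ↭-trans)
  open import Data.List.Relation.Binary.Permutation.Propositional.Properties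
    using (∈-resp-↭; ↭-length; filter-↭; shift; ++⁺ˡ)
  open import Data.Product using (Σ; _×_; _,_; proj₂)
  open import Data.Sum using (_⊎_; inj₁; inj₂)
  open import Data.Empty using (⊥; ⊥-elim)
  open import Function using (_∘_)
  open import Relation.Nullary using (¬_; yes; no)
  open import Relation.Nullary.Decidable using (¬?)
  open import Relation.Unary using (Decidable)
  open import Relation.Binary.PropositionalEquality
    using (_≡_; _≢_; refl; sym; trans; cong; cong₂; subst; module ≡-Reasoning)

  shares-sym : ∀ {e f} → Shares e f → Shares f e
  shares-sym (inj₁ (inj₁ p)) = inj₁ (inj₁ (sym p))
  shares-sym (inj₁ (inj₂ p)) = inj₂ (inj₁ (sym p))
  shares-sym (inj₂ (inj₁ p)) = inj₁ (inj₂ (sym p))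
  shares-sym (inj₂ (inj₂ p)) = inj₂ (inj₂ (sym p))

  adjacent-sym : ∀ {e f} → Adjacent e f → Adjacent f e
  adjacent-sym {e} {f} (e≢f , s) = e≢f ∘ sym , shares-sym {e} {f} s

  PairwiseNonAdjacent : List Edge → Set
  PairwiseNonAdjacent Z = ∀ {e f} → e ∈ Z → f ∈ Z → ¬ Adjacent e f

  matching⇒pairwiseNonAdjacent : ∀ {Z} → IsMatching Z → PairwiseNonAdjacent Z
  matching⇒pairwiseNonAdjacent (_ , disjoint) = go disjoint
    where
    go : ∀ {Z} → AllPairs (λ e f → ¬ Shares e f) Z → PairwiseNonAdjacent Z
    go (_ ∷ _)          (here refl) (here refl) (e≢e , _) = e≢e refl
    go (h ∷ _)          (here refl) (there f∈)  (_ , s)   = All.lookup h f∈ s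
    go (h ∷ _)  {e} {f} (there e∈)  (here refl) (_ , s)   = All.lookup h e∈ (shares-sym {e} {f} s)
    go (_ ∷ hs)         (there e∈)  (there f∈)  adj       = go hs e∈ f∈ adj

  pairwiseNonAdjacent-↭ : ∀ {Z Z′} → Z′ ↭ Z → PairwiseNonAdjacent Z → PairwiseNonAdjacent Z′
  pairwiseNonAdjacent-↭ Z′↭Z nonAdj e∈ f∈ = nonAdj (∈-resp-↭ Z′↭Z e∈) (∈-resp-↭ Z′↭Z f∈)

  Incident : ℕ → Edge → Set
  Incident v z = a z ≡ v ⊎ b z ≡ v

  incident⇒shares : ∀ {v z w} → Incident v z → Incident v w → Shares z w
  incident⇒shares (inj₁ p) (inj₁ q) = inj₁ (inj₁ (trans p (sym q)))
  incident⇒shares (inj₁ p) (inj₂ q) = inj₁ (inj₂ (trans p (sym q)))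
  incident⇒shares (inj₂ p) (inj₁ q) = inj₂ (inj₁ (trans p (sym q)))
  incident⇒shares (inj₂ p) (inj₂ q) = inj₂ (inj₂ (trans p (sym q)))

  shares⇒incident : ∀ {e z} → Shares e z → Incident (a e) z ⊎ Incident (b e) z
  shares⇒incident (inj₁ (inj₁ p)) = inj₁ (inj₁ (sym p))
  shares⇒incident (inj₁ (inj₂ p)) = inj₁ (inj₂ (sym p))
  shares⇒incident (inj₂ (inj₁ p)) = inj₂ (inj₁ (sym p))
  shares⇒incident (inj₂ (inj₂ p)) = inj₂ (inj₂ (sym p))

  -- Pigeonhole: two of the three edges meet e in the same endpoint.
  no-three-disjoint-neighbours : ∀ {e z₁ z₂ z₃} → Shares e z₁ → Shares e z₂ → Shares e z₃ →
    ¬ Shares z₁ z₂ → ¬ Shares z₁ z₃ → ¬ Shares z₂ z₃ → ⊥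
  no-three-disjoint-neighbours {e} {z₁} {z₂} {z₃} s₁ s₂ s₃ n₁₂ n₁₃ n₂₃
    with shares⇒incident {e} {z₁} s₁ | shares⇒incident {e} {z₂} s₂ | shares⇒incident {e} {z₃} s₃
  ... | inj₁ i₁ | inj₁ i₂ | _       = n₁₂ (incident⇒shares {z = z₁} {z₂} i₁ i₂)
  ... | inj₂ i₁ | inj₂ i₂ | _       = n₁₂ (incident⇒shares {z = z₁} {z₂} i₁ i₂)
  ... | inj₁ i₁ | inj₂ _  | inj₁ i₃ = n₁₃ (incident⇒shares {z = z₁} {z₃} i₁ i₃)
  ... | inj₁ _  | inj₂ i₂ | inj₂ i₃ = n₂₃ (incident⇒shares {z = z₂} {z₃} i₂ i₃)
  ... | inj₂ _  | inj₁ i₂ | inj₁ i₃ = n₂₃ (incident⇒shares {z = z₂} {z₃} i₂ i₃)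
  ... | inj₂ i₁ | inj₁ _  | inj₂ i₃ = n₁₃ (incident⇒shares {z = z₁} {z₃} i₁ i₃)

  nbrs≤2 : ∀ {X} e → IsMatching X → nbrs X e ≤ 2
  nbrs≤2 {X} e (_ , disjoint) =
    length≤2 (AllPairs.filter⁺ (adjacent? e) disjoint) (all-filter (adjacent? e) X)
    where
    length≤2 : ∀ {Z} → AllPairs (λ z w → ¬ Shares z w) Z → All (Adjacent e) Z → length Z ≤ 2
    length≤2 {[]} _ _ = z≤n
    length≤2 {_ ∷ []} _ _ = s≤s z≤n
    length≤2 {_ ∷ _ ∷ []} _ _ = s≤s (s≤s z≤n)
    length≤2 {z₁ ∷ z₂ ∷ z₃ ∷ _} ((n₁₂ ∷ n₁₃ ∷ _) ∷ (n₂₃ ∷ _) ∷ _)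
                                ((_ , s₁) ∷ (_ , s₂) ∷ (_ , s₃) ∷ _) =
      ⊥-elim (no-three-disjoint-neighbours {e} {z₁} {z₂} {z₃} s₁ s₂ s₃ n₁₂ n₁₃ n₂₃)

  nbrs-mono : ∀ {X X′} e → X ⊆ X′ → nbrs X e ≤ nbrs X′ e
  nbrs-mono e X⊆X′ = length-mono-≤ (filter⁺ (adjacent? e) (adjacent? e) (λ { refl p → p }) X⊆X′)

  filter-++-reject-↭ : ∀ {A : Set} {P : A → Set} (P? : Decidable P) xs →
    filter P? xs ++ filter (¬? ∘ P?) xs ↭ xs
  filter-++-reject-↭ P? [] = refl
  filter-++-reject-↭ P? (x ∷ xs) with P? x
  ... | yes _ = prep x (filter-++-reject-↭ P? xs)
  ... | no _  = ↭-trans (shift x (filter P? xs) _) (prep x (filter-++-reject-↭ P? xs))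

  greedy : List Edge → List Edge → List Edge
  greedy X []       = X
  greedy X (y ∷ ys) = filter (adjacent? y) X ++ greedy (filter (¬? ∘ adjacent? y) X) ys

  greedy-↭ : ∀ X ys → greedy X ys ↭ X
  greedy-↭ X []       = refl
  greedy-↭ X (y ∷ ys) =
    ↭-trans (++⁺ˡ (filter (adjacent? y) X) (greedy-↭ _ ys)) (filter-++-reject-↭ (adjacent? y) X)

  degreePrefix : List Edge → List Edge → ℕ → ℕ
  degreePrefix X ys n = sum (take n (map (nbrs X) ys))

  degreePrefix-mono : ∀ {X X′} → X ⊆ X′ → ∀ ys n → degreePrefix X ys n ≤ degreePrefix X′ ys n
  degreePrefix-mono X⊆X′ ys       zero    = z≤n
  degreePrefix-mono X⊆X′ []       (suc n) = z≤n
  degreePrefix-mono X⊆X′ (y ∷ ys) (suc n) = +-mono-≤ (nbrs-mono y X⊆X′) (degreePrefix-mono X⊆X′ ys n)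

  lookup-++-split : ∀ (xs ys : List Edge) (i : Fin (length (xs ++ ys))) →
    (Σ (Fin (length xs)) λ i′ → toℕ i ≡ toℕ i′ × lookup (xs ++ ys) i ≡ lookup xs i′) ⊎
    (Σ (Fin (length ys)) λ j → toℕ i ≡ length xs + toℕ j × lookup (xs ++ ys) i ≡ lookup ys j)
  lookup-++-split []       ys i       = inj₂ (i , refl , refl)
  lookup-++-split (x ∷ xs) ys zero    = inj₁ (zero , refl , refl)
  lookup-++-split (x ∷ xs) ys (suc i) with lookup-++-split xs ys i
  ... | inj₁ (i′ , p , q) = inj₁ (suc i′ , cong suc p , q)
  ... | inj₂ (j , p , q)  = inj₂ (j , cong suc p , q)

  -- An edge of X adjacent to ys[j] is placed no later than the block of ys[j],
  -- and the blocks of ys[0], …, ys[j] have at most degreePrefix X ys (j + 1) edges.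
  greedy-position : ∀ X ys (i : Fin (length (greedy X ys))) (j : Fin (length ys)) →
    Adjacent (lookup (greedy X ys) i) (lookup ys j) → toℕ i < degreePrefix X ys (suc (toℕ j))
  greedy-position X (y ∷ ys) i j adj with lookup-++-split (filter (adjacent? y) X) (greedy _ ys) i
  ... | inj₁ (i′ , i≡i′ , _) rewrite i≡i′ = <-≤-trans (toℕ<n i′) (first-block≤ j)
    where
    first-block≤ : ∀ (j : Fin (suc (length ys))) → nbrs X y ≤ degreePrefix X (y ∷ ys) (suc (toℕ j))
    first-block≤ zero    = ≤-reflexive (sym (+-identityʳ _))
    first-block≤ (suc j) = m≤m+n _ _
  greedy-position X (y ∷ ys) i zero adj | inj₂ (i′ , _ , lookup≡) rewrite lookup≡ =
    ⊥-elim (proj₂ (∈-filter⁻ (¬? ∘ adjacent? y) {xs = X} placed∈rest) (adjacent-sym {placed} {y} adj))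
    where
    rest = filter (¬? ∘ adjacent? y) X
    placed = lookup (greedy rest ys) i′
    placed∈rest : placed ∈ rest
    placed∈rest = ∈-resp-↭ (greedy-↭ rest ys) (∈-lookup i′)
  greedy-position X (y ∷ ys) i (suc j) adj | inj₂ (i′ , i≡ , lookup≡) rewrite i≡ | lookup≡ =
    +-monoʳ-< (nbrs X y) (<-≤-trans (greedy-position _ ys i′ j adj)
      (degreePrefix-mono (filter-⊆ (¬? ∘ adjacent? y) X) ys (suc (toℕ j))))

  -- The walk sum (take n ws) − n first never rises and then only rises,
  -- so it stays below max(0, its final height).
  prefix-sum-bound : ∀ {us vs : List ℕ} {k} → All (_≤ 1) us → All (_≡ 2) vs →
    sum us + length vs ≤ length us + k → ∀ n → sum (take n (us ++ vs)) ≤ n + k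
  prefix-sum-bound _ _ _ zero = z≤n
  prefix-sum-bound {[]} {[]} _ _ _ (suc n) = z≤n
  prefix-sum-bound {[]} {2 ∷ vs} [] (refl ∷ twos) (s≤s total) (suc n) =
    s≤s (≤-trans (s≤s (prefix-sum-bound {[]} [] twos total n)) (≤-reflexive (sym (+-suc n _))))
  prefix-sum-bound {0 ∷ us} (z≤n ∷ ones) twos total (suc n) =
    ≤-trans (prefix-sum-bound ones twos (≤-trans total (≤-reflexive (sym (+-suc _ _)))) n)
            (≤-reflexive (+-suc n _))
  prefix-sum-bound {1 ∷ us} (s≤s z≤n ∷ ones) twos (s≤s total) (suc n) =
    s≤s (prefix-sum-bound ones twos total n)

  spread-++ : ∀ P Q {s} → PairwiseNonAdjacent P → PairwiseNonAdjacent Q →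
    (∀ (i : Fin (length P)) (j : Fin (length Q)) →
       Adjacent (lookup P i) (lookup Q j) → s ≤ (length P + toℕ j) ∸ toℕ i) →
    Spread (P ++ Q) s
  spread-++ P Q nonAdjP nonAdjQ cross i j i<j adj with lookup-++-split P Q i | lookup-++-split P Q j
  ... | inj₁ (i′ , _ , pi) | inj₁ (j′ , _ , pj) rewrite pi | pj =
    ⊥-elim (nonAdjP (∈-lookup i′) (∈-lookup j′) adj)
  ... | inj₂ (i′ , _ , pi) | inj₂ (j′ , _ , pj) rewrite pi | pj =
    ⊥-elim (nonAdjQ (∈-lookup i′) (∈-lookup j′) adj)
  ... | inj₁ (i′ , i≡ , pi) | inj₂ (j′ , j≡ , pj) rewrite pi | pj | i≡ | j≡ = cross i′ j′ adj
  ... | inj₂ (i′ , i≡ , _) | inj₁ (j′ , j≡ , _) =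
    ⊥-elim (<-irrefl refl (<-trans (≤-<-trans (subst (length P ≤_) (sym i≡) (m≤m+n _ _)) i<j)
                                   (subst (_< length P) (sym j≡) (toℕ<n j′))))

  spread⇒≤ms : ∀ {L s t} → IsMs L s → Spread L t → t ≤ length L → t ≤ s
  spread⇒≤ms (_ , _ , maximal) spread t≤len = ≮⇒≥ λ s<t → maximal _ s<t t≤len spread

  i≤j+k⇒m∸k≤[m+j]∸i : ∀ m {i j k} → i ≤ j + k → m ∸ k ≤ (m + j) ∸ i
  i≤j+k⇒m∸k≤[m+j]∸i m {i} {j} {k} i≤j+k = begin
    m ∸ k             ≡⟨ [m+n]∸[m+o]≡n∸o j m k ⟨
    (j + m) ∸ (j + k) ≤⟨ ∸-monoʳ-≤ (j + m) i≤j+k ⟩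
    (j + m) ∸ i       ≡⟨ cong (_∸ i) (+-comm j m) ⟩
    (m + j) ∸ i       ∎
    where open ≤-Reasoning

  countAdj-↭ : ∀ X {Y Y′} k → Y′ ↭ Y → countAdj X Y′ k ≡ countAdj X Y k
  countAdj-↭ X k Y′↭Y = ↭-length (filter-↭ (λ e → nbrs X e ≟ k) Y′↭Y)

  countAdj-++ : ∀ X A B k → countAdj X (A ++ B) k ≡ countAdj X A k + countAdj X B k
  countAdj-++ X A B k = trans (cong length (filter-++ P? A B)) (length-++ (filter P? A))
    where P? = λ e → nbrs X e ≟ k

  countAdj-none : ∀ X {A} k → All (λ e → nbrs X e ≢ k) A → countAdj X A k ≡ 0
  countAdj-none X k none = cong length (filter-none (λ e → nbrs X e ≟ k) none)

  countAdj-all : ∀ X {A} k → All (λ e → nbrs X e ≡ k) A → countAdj X A k ≡ length A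
  countAdj-all X k all = cong length (filter-all (λ e → nbrs X e ≟ k) all)

  sum≤count₁ : ∀ {A : Set} (f : A → ℕ) {xs} → All (λ x → f x ≤ 1) xs →
    sum (map f xs) ≤ length (filter (λ x → f x ≟ 1) xs)
  sum≤count₁ f [] = z≤n
  sum≤count₁ f {x ∷ xs} (≤1 ∷ ≤1s) with f x ≟ 1
  ... | yes ≡1 = begin
    f x + sum (map f xs)       ≤⟨ +-mono-≤ (≤-reflexive ≡1) (sum≤count₁ f ≤1s) ⟩
    suc (length (filter P? xs)) ≡⟨ cong length (filter-accept P? ≡1) ⟨
    length (filter P? (x ∷ xs)) ∎
    where open ≤-Reasoning
          P? = λ x → f x ≟ 1
  ... | no ≢1  = begin
    f x + sum (map f xs)       ≡⟨ cong (_+ sum (map f xs)) (n≤0⇒n≡0 (s≤s⁻¹ (≤∧≢⇒< ≤1 ≢1))) ⟩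
    sum (map f xs)             ≤⟨ sum≤count₁ f ≤1s ⟩
    length (filter P? xs)       ≡⟨ cong length (filter-reject P? ≢1) ⟨
    length (filter P? (x ∷ xs)) ∎
    where open ≤-Reasoning
          P? = λ x → f x ≟ 1

  countAdj₁-layered : ∀ X A B {Y} → A ++ B ↭ Y → All (λ e → nbrs X e ≡ 2) B →
    countAdj X Y 1 ≡ countAdj X A 1
  countAdj₁-layered X A B {Y} AB↭Y two = begin
    countAdj X Y 1                  ≡⟨ countAdj-↭ X 1 AB↭Y ⟨
    countAdj X (A ++ B) 1           ≡⟨ countAdj-++ X A B 1 ⟩
    countAdj X A 1 + countAdj X B 1 ≡⟨ cong (countAdj X A 1 +_) (countAdj-none X 1 (All.map ≢1 two)) ⟩
    countAdj X A 1 + 0              ≡⟨ +-identityʳ _ ⟩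
    countAdj X A 1                  ∎
    where
    open ≡-Reasoning
    ≢1 : ∀ {n} → n ≡ 2 → n ≢ 1
    ≢1 refl ()

  countAdj₂-layered : ∀ X A B {Y} → A ++ B ↭ Y →
    All (λ e → nbrs X e ≢ 2) A → All (λ e → nbrs X e ≡ 2) B → countAdj X Y 2 ≡ length B
  countAdj₂-layered X A B {Y} AB↭Y notTwo two = begin
    countAdj X Y 2                  ≡⟨ countAdj-↭ X 2 AB↭Y ⟨
    countAdj X (A ++ B) 2           ≡⟨ countAdj-++ X A B 2 ⟩
    countAdj X A 2 + countAdj X B 2 ≡⟨ cong₂ _+_ (countAdj-none X 2 notTwo) (countAdj-all X 2 two) ⟩
    length B                        ∎
    where open ≡-Reasoning

  module _ (X A B : List Edge) (matchX : IsMatching X)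
           (notTwo : All (λ e → nbrs X e ≢ 2) A) (two : All (λ e → nbrs X e ≡ 2) B) where

    excess : ℕ
    excess = (countAdj X A 1 + length B) ∸ length A

    atMostOne : All (λ e → nbrs X e ≤ 1) A
    atMostOne = All.map (λ {e} ≢2 → s≤s⁻¹ (≤∧≢⇒< (nbrs≤2 e matchX) ≢2)) notTwo

    degreePrefix≤ : ∀ n → degreePrefix X (A ++ B) n ≤ n + excess
    degreePrefix≤ n = subst (λ ws → sum (take n ws) ≤ n + excess) (sym (map-++ (nbrs X) A B))
      (prefix-sum-bound (All-map⁺ atMostOne) (All-map⁺ two) excess-bound n)
      where
      excess-bound : sum (map (nbrs X) A) + length (map (nbrs X) B) ≤ length (map (nbrs X) A) + excess
      excess-bound = begin
        sum (map (nbrs X) A) + length (map (nbrs X) B)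
          ≤⟨ +-mono-≤ (sum≤count₁ (nbrs X) atMostOne) (≤-reflexive (length-map _ B)) ⟩
        countAdj X A 1 + length B                      ≤⟨ m≤n+m∸n _ (length A) ⟩
        length A + excess                              ≡⟨ cong (_+ excess) (length-map _ A) ⟨
        length (map (nbrs X) A) + excess               ∎
        where open ≤-Reasoning

    greedy-spread : PairwiseNonAdjacent (A ++ B) →
      Spread (greedy X (A ++ B) ++ A ++ B) (length X ∸ excess)
    greedy-spread nonAdjAB = spread-++ ℓX (A ++ B) nonAdjℓX nonAdjAB cross
      where
      ℓX = greedy X (A ++ B)
      nonAdjℓX : PairwiseNonAdjacent ℓX
      nonAdjℓX = pairwiseNonAdjacent-↭ (greedy-↭ X (A ++ B)) (matching⇒pairwiseNonAdjacent matchX)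
      before : ∀ i j → Adjacent (lookup ℓX i) (lookup (A ++ B) j) → toℕ i ≤ toℕ j + excess
      before i j adj =
        s≤s⁻¹ (<-≤-trans (greedy-position X (A ++ B) i j adj) (degreePrefix≤ (suc (toℕ j))))
      cross : ∀ i j → Adjacent (lookup ℓX i) (lookup (A ++ B) j) →
        length X ∸ excess ≤ (length ℓX + toℕ j) ∸ toℕ i
      cross i j adj = subst (λ m → length X ∸ excess ≤ (m + toℕ j) ∸ toℕ i)
        (sym (↭-length (greedy-↭ X (A ++ B)))) (i≤j+k⇒m∸k≤[m+j]∸i (length X) (before i j adj))

    greedy-ms : PairwiseNonAdjacent (A ++ B) →
      ∀ {s} → IsMs (greedy X (A ++ B) ++ A ++ B) s → length X ∸ excess ≤ s
    greedy-ms nonAdjAB ms = spread⇒≤ms {ℓX ++ A ++ B} ms (greedy-spread nonAdjAB) (begin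
      length X ∸ excess             ≤⟨ m∸n≤m _ excess ⟩
      length X                      ≡⟨ ↭-length (greedy-↭ X (A ++ B)) ⟨
      length ℓX                     ≤⟨ m≤m+n _ _ ⟩
      length ℓX + length (A ++ B)   ≡⟨ length-++ ℓX ⟨
      length (ℓX ++ A ++ B)         ∎)
      where
      open ≤-Reasoning
      ℓX = greedy X (A ++ B)

open GreedyOrdering

import Data.Nat as ℕ
import Data.Nat.Properties as ℕ
open import Data.Integer using (ℤ; +_; _+_; _-_; _*_; _⊓_; _≤_; +≤+)
open import Data.Integer.Properties
  using (≤-trans; ≤-refl; i⊓j≤i; i⊓j≤j; pos-+; m-n≡m⊖n; ⊖-≥; ⊖-<; neg-≤-pos)
open import Data.Integer.Tactic.RingSolver using (solve-∀)
open import Data.List using (List; length; _++_)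
open import Data.List.Properties using (length-++)
open import Data.List.Relation.Unary.All using (All)
open import Data.List.Relation.Binary.Permutation.Propositional using (_↭_)
open import Data.List.Relation.Binary.Permutation.Propositional.Properties using (↭-length)
open import Data.Product using (Σ; _×_; _,_)
open import Relation.Nullary using (yes; no)
open import Relation.Binary.PropositionalEquality
  using (_≡_; _≢_; refl; sym; trans; cong; subst; module ≡-Reasoning)

m-n≤m∸n : ∀ m n → + m - + n ≤ + (m ℕ.∸ n)
m-n≤m∸n m n rewrite m-n≡m⊖n m n with n ℕ.≤? m
... | yes n≤m rewrite ⊖-≥ n≤m = ≤-refl
... | no n≰m rewrite ⊖-< (ℕ.≰⇒> n≰m) = neg-≤-pos

m⊓[m+n-o]≤m∸[o∸n] : ∀ m n o → + m ⊓ (+ m + + n - + o) ≤ + (m ℕ.∸ (o ℕ.∸ n))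
m⊓[m+n-o]≤m∸[o∸n] m n o with o ℕ.≤? n
... | yes o≤n rewrite ℕ.m≤n⇒m∸n≡0 o≤n = i⊓j≤i (+ m) _
... | no o≰n = ≤-trans (i⊓j≤j (+ m) _) (subst (_≤ + (m ℕ.∸ d)) (sym rearranged) (m-n≤m∸n m d))
  where
  d = o ℕ.∸ n
  cancel : ∀ (i j k : ℤ) → i + j - (j + k) ≡ i - k
  cancel = solve-∀
  rearranged : + m + + n - + o ≡ + m - + d
  rearranged = begin
    + m + + n - + o         ≡⟨ cong (λ k → + m + + n - + k) (ℕ.m+[n∸m]≡n (ℕ.≰⇒≥ o≰n)) ⟨
    + m + + n - + (n ℕ.+ d) ≡⟨ cong (λ k → + m + + n - k) (pos-+ n d) ⟩
    + m + + n - (+ n + + d) ≡⟨ cancel (+ m) (+ n) (+ d) ⟩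
    + m - + d               ∎
    where open ≡-Reasoning

∸-bound⇒⊓-bound : ∀ x a b c {s} → x ℕ.∸ ((c ℕ.+ b) ℕ.∸ a) ℕ.≤ s →
  + x ⊓ (+ x + + (a ℕ.+ b) - + c - + 2 * + b) ≤ + s
∸-bound⇒⊓-bound x a b c ≤s = subst (λ z → + x ⊓ z ≤ _) (sym regrouped)
  (≤-trans (m⊓[m+n-o]≤m∸[o∸n] x a (c ℕ.+ b)) (+≤+ ≤s))
  where
  regroup : ∀ (i j k l : ℤ) → i + (j + k) - l - + 2 * k ≡ i + j - (l + k)
  regroup = solve-∀
  regrouped : + x + + (a ℕ.+ b) - + c - + 2 * + b ≡ + x + + a - + (c ℕ.+ b)
  regrouped = begin
    + x + + (a ℕ.+ b) - + c - + 2 * + b ≡⟨ cong (λ k → + x + k - + c - + 2 * + b) (pos-+ a b) ⟩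
    + x + (+ a + + b) - + c - + 2 * + b ≡⟨ regroup (+ x) (+ a) (+ b) (+ c) ⟩
    + x + + a - (+ c + + b)             ≡⟨ cong (λ k → + x + + a - k) (pos-+ c b) ⟨
    + x + + a - + (c ℕ.+ b)             ∎
    where open ≡-Reasoning

lemma2p6 : (X Y : List Edge) → IsMatching X → IsMatching Y → EdgeDisjoint X Y →
    (ℓY : List Edge) → ℓY ↭ Y →
    (A B : List Edge) → ℓY ≡ A ++ B →
    All (λ e → nbrs X e ≢ 2) A → All (λ e → nbrs X e ≡ 2) B →
    Σ (List Edge) λ ℓX → ℓX ↭ X ×
      (∀ s → IsMs (ℓX ++ ℓY) s →
        (+ length X) ⊓ (+ length X + + length Y - + countAdj X Y 1 - + 2 * + countAdj X Y 2) ≤ + s)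
lemma2p6 X Y matchX matchY _ .(A ++ B) AB↭Y A B refl notTwo two =
  greedy X (A ++ B) , greedy-↭ X (A ++ B) , bound
  where
  lengthY : length Y ≡ length A ℕ.+ length B
  lengthY = trans (sym (↭-length AB↭Y)) (length-++ A)
  nonAdjAB : PairwiseNonAdjacent (A ++ B)
  nonAdjAB = pairwiseNonAdjacent-↭ AB↭Y (matching⇒pairwiseNonAdjacent matchY)
  bound : ∀ s → IsMs (greedy X (A ++ B) ++ A ++ B) s →
    (+ length X) ⊓ (+ length X + + length Y - + countAdj X Y 1 - + 2 * + countAdj X Y 2) ≤ + s
  bound s ms
    rewrite lengthY | countAdj₁-layered X A B AB↭Y two | countAdj₂-layered X A B AB↭Y notTwo two =
    ∸-bound⇒⊓-bound (length X) (length A) (length B) (countAdj X A 1)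
      (greedy-ms X A B matchX notTwo two nonAdjAB ms)
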